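{- Let $H$ be an unweighted hypergraph of rank $r$ on $n$ vertices and $k$ a positive integer. Suppose $\textsc{Partition}(H',t)$ is a procedure that, given a hypergraph $H'$ and integer $t$, returns a $2t$-light $t$-partition of $H'$. Consider the algorithm $\textsc{WeakEdges}(H,k)$: set $E'=\emptyset$; repeat $1+\log_2 n$ times: $E'\gets E'\cup\textsc{Partition}(H,2rk)$ and $H\gets H-E'$; return $E'$. Then $\textsc{WeakEdges}(H,k)$ returns a $4rk$-light set $E'$ (with respect to the input hypergraph $H$) that contains all the $k$-weak edges of $H$, using $O(\log n)$ calls to $\textsc{Partition}$.
   Context: A hypergraph $H=(V,E)$ has finite vertex set $V$ and a (multi)set $E$ of edges, each a nonempty subset of $V$; its rank is $\max_{e\in E}|e|$. For $U\subseteq V$, $H[U]=(U,\{e\in E:e\subseteq U\})$. For $A\subseteq V$, $\delta_H(A)=\{e\in E: e\cap A\ne\emptyset,\ e\cap (V\setminus A)\ne\emptyset\}$. $\lambda(H)=\min_{\emptyset\subsetneq A\subsetneq V}|\delta_H(A)|$ and the strength of $e$ is $\gamma_H(e)=\max_{e\subseteq U\subseteq V}\lambda(H[U])$. An edge is $k$-weak if $\gamma_H(e)<k$. $\kappa(H)$ is the number of connected components of $H$, and $H-E'$ denotes $H$ with edges $E'$ deleted. A set $E'\subseteq E$ is $\ell$-light if $|E'|\le\ell(\kappa(H-E')-\kappa(H))$. An edge $e$ is $t$-crisp in $H$ if there is $X\subseteq V$ with $e\in\delta_H(X)$ and $|\delta_H(X)|<t$. A set $E'\subseteq E$ is a $t$-partition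 of $H$ if it contains all $t$-crisp edges of $H$. -}

module Defs where

open import Data.Nat using (ℕ; zero; suc; _+_; _*_; _∸_; _≤_; _<_; _⊔_)
open import Data.Bool using (Bool; true; false; _∧_; _∨_; not; T)
open import Data.Fin using (Fin)
open import Data.Fin.Subset using (Subset; _∈_; _∉_; _⊆_; _∩_; _∪_; _─_; ∁; ⊤; ⊥; ∣_∣; Nonempty)
open import Data.Vec using (Vec; []; _∷_; lookup; tabulate)
open import Data.List using (foldr; map; allFin)
open import Data.Product using (Σ; ∃; _×_; _,_)
open import Relation.Binary.PropositionalEquality using (_≡_)
open import Function.Bundles using (_⇔_)
open import Function.Definitions using (Surjective)

-- A hypergraph on vertex set Fin n with m edges (a multiset: edges are
-- indexed by Fin m, repetitions allowed) is given by  E : Fin m → Subset n.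
-- A spanning sub-hypergraph (obtained by deleting edges) is described by a
-- mask  S : Subset m  of the edge indices that are still present.
-- So (E , S) denotes the hypergraph (Fin n , {E i : i ∈ S}), and
-- H - E' corresponds to the mask  S ─ E'.

anyᵇ : ∀ {n} → Vec Bool n → Bool
anyᵇ []       = false
anyᵇ (b ∷ bs) = b ∨ anyᵇ bs

subᵇ : ∀ {n} → Subset n → Subset n → Bool
subᵇ e U = not (anyᵇ (e ─ U))

crossᵇ : ∀ {n} → Subset n → Subset n → Subset n → Bool
crossᵇ e U A = anyᵇ (e ∩ A) ∧ anyᵇ (e ∩ (U ─ A))

-- the set of edge indices of δ_{H[U]}(A), where H = (E , S):
-- edges of H[U] (present edges contained in U) meeting both A and U ∖ A
δ : ∀ {n m} → (Fin m → Subset n) → Subset m → Subset n → Subset n → Subset m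
δ E S U A = tabulate (λ i → lookup S i ∧ (subᵇ (E i) U ∧ crossᵇ (E i) U A))

cutSize : ∀ {n m} → (Fin m → Subset n) → Subset m → Subset n → Subset n → ℕ
cutSize E S U A = ∣ δ E S U A ∣

rank : ∀ {n m} → (Fin m → Subset n) → ℕ
rank {m = m} E = foldr _⊔_ 0 (map (λ i → ∣ E i ∣) (allFin m))

-- λ(H[U]) < k, where λ(H[U]) = min over ∅ ≠ A ⊊ U of |δ_{H[U]}(A)|
-- (min over the empty family = ∞, so this fails when |U| ≤ 1)
LambdaLt : ∀ {n m} → (Fin m → Subset n) → Subset m → Subset n → ℕ → Set
LambdaLt E S U k =
  ∃ λ A → A ⊆ U × Nonempty A × (∃ λ v → v ∈ U × v ∉ A) × cutSize E S U A < k

-- edge i is k-weak in H = (E , S):  γ_H(e) = max_{e ⊆ U} λ(H[U]) < k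
Weak : ∀ {n m} → (Fin m → Subset n) → Subset m → ℕ → Fin m → Set
Weak E S k i = ∀ U → E i ⊆ U → LambdaLt E S U k

Crisp : ∀ {n m} → (Fin m → Subset n) → Subset m → ℕ → Fin m → Set
Crisp E S t i =
  i ∈ S × (∃ λ X → T (crossᵇ (E i) ⊤ X) × cutSize E S ⊤ X < t)

IsPartition : ∀ {n m} → (Fin m → Subset n) → Subset m → ℕ → Subset m → Set
IsPartition E S t P = P ⊆ S × (∀ i → Crisp E S t i → i ∈ P)

data Conn {n m} (E : Fin m → Subset n) (S : Subset m) : Fin n → Fin n → Set where
  here : ∀ {u} → Conn E S u u
  step : ∀ {u w v} (i : Fin m) → i ∈ S → u ∈ E i → w ∈ E i →
         Conn E S w v → Conn E S u v

-- κ(H) = c : the connected components of H are in bijection with Fin c,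
-- via a surjective labelling identifying exactly the connected vertices
HasComponents : ∀ {n m} → (Fin m → Subset n) → Subset m → ℕ → Set
HasComponents {n} E S c =
  Σ (Fin n → Fin c) λ f →
    Surjective _≡_ _≡_ f × (∀ u v → (f u ≡ f v) ⇔ Conn E S u v)

Light : ∀ {n m} → (Fin m → Subset n) → Subset m → ℕ → Subset m → Set
Light E S ℓ P =
  ∀ c c' → HasComponents E S c → HasComponents E (S ─ P) c' →
  ∣ P ∣ ≤ ℓ * (c' ∸ c)

PartitionProc : ∀ {n m} → (Fin m → Subset n) → Set
PartitionProc {m = m} E = Subset m → ℕ → Subset m

PartitionSpec : ∀ {n m} (E : Fin m → Subset n) → PartitionProc E → Set
PartitionSpec E part =
  ∀ S t → IsPartition E S t (part S t) × Light E S (2 * t) (part S t)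

-- the loop of WeakEdges: j remaining rounds, current hypergraph (mask S),
-- accumulated set acc, number of calls so far; returns (E', #calls)
weakLoop : ∀ {n m} (E : Fin m → Subset n) → PartitionProc E → ℕ →
           ℕ → Subset m → Subset m → ℕ → Subset m × ℕ
weakLoop E part t zero    S acc calls = acc , calls
weakLoop E part t (suc j) S acc calls =
  let acc' = acc ∪ part S t in
  weakLoop E part t j (S ─ acc') acc' (suc calls)

weakEdges : ∀ {n m} (E : Fin m → Subset n) → PartitionProc E →
            (r k rounds : ℕ) → Subset m × ℕ
weakEdges E part r k rounds = weakLoop E part (2 * r * k) rounds ⊤ ⊥ 0

module Submission where

-- Lightness: round j removes a 2t-light partition P_j (t = 2rk) of the
-- current hypergraph H_j; the bounds |P_j| ≤ 2t (κ(H_{j+1}) - κ(H_j))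
-- telescope, so the union of the P_j is 2t = 4rk-light for H (Rounds).
--
-- Weak edges: call u, v k-equivalent when some vertex set containing both
-- has λ ≥ k.  The classes are k-connected, and an edge is k-weak iff it
-- meets two classes (StrongClasses).  Inside a union of classes, the
-- inter-class edges touching b classes number at most k (b - 1): a light
-- cut splits the union into smaller unions of classes (sparse).  A class of
-- degree < t in H_j loses all its edges to P_j, since they are t-crisp, and
-- each edge meets at most r classes; double counting t·#heavy ≤ r·#edges ≤
-- rk (b - 1) shows that the number b of classes still touched by
-- inter-class edges halves in every round (Halving).  After 1 + ⌊log₂ n⌋
-- rounds it is 0, so every weak edge has been removed.

open import Defs
open import Data.Nat using (ℕ; suc; _*_; _≤_)
open import Data.Nat.Logarithm using (⌊log₂_⌋)
open import Data.Fin using (Fin)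
open import Data.Fin.Subset using (Subset; _∈_; ⊤; Nonempty)
open import Data.Product using (_×_; proj₁; proj₂)
open import Relation.Binary.PropositionalEquality using (_≡_)

open import Data.Nat using (zero; _+_; _∸_; _^_; _<_; _⊔_; z≤n; s≤s; >-nonZero)
open import Data.Nat.Properties
open import Data.Nat.Logarithm using (⌊log₂⌋-mono-≤; ⌊log₂[2^n]⌋≡n)
open import Data.Nat.Induction using (<-wellFounded)
open import Data.Nat.Solver using (module +-*-Solver)
open +-*-Solver using (solve; _:+_; _:*_; _:=_; con)
open import Data.Bool using (Bool; true; false; not; T)
open import Data.Bool.Properties using (T-∧; T-≡)
open import Data.Fin using (zero; suc)
open import Data.Fin.Properties using (any?; injective⇒≤)
import Data.Fin.Properties as Fin
open import Data.Fin.Subset using (_∉_; _⊆_; _∩_; _∪_; _─_; ⊥; ∣_∣; Empty; ⁅_⁆)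
open import Data.Fin.Subset.Properties
  using ( _∈?_; _⊆?_; nonempty?; anySubset?; ∈⊤; ⊆⊤; ⊆-trans; Empty-unique
        ; x∈⁅x⁆; x∈⁅y⁆⇒x≡y; x∈p∩q⁺; x∈p∩q⁻; x∈p∪q⁻; p⊆p∪q; q⊆p∪q; p∩q⊆p; p∩q⊆q
        ; ∪-assoc; ∪-idem; p─⊥≡p; p─q─r≡p─q∪r; p─q⊆p; x∈p∧x∉q⇒x∈p─q
        ; ∣p∣≤n; ∣⊥∣≡0; ∣⁅x⁆∣≡1; p⊆q⇒∣p∣≤∣q∣; p⊂q⇒∣p∣<∣q∣; p∩q≢∅⇒∣p─q∣<∣p∣ )
open import Data.Vec using ([]; _∷_; lookup; tabulate; here; there)
open import Data.Vec.Properties using ([]=⇒lookup; lookup⇒[]=; lookup∘tabulate)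
open import Data.List as List using (List)
open import Data.List.Membership.Propositional using () renaming (_∈_ to _∈ₗ_)
open import Data.List.Membership.Propositional.Properties using (∈-map⁺; ∈-allFin)
open import Data.List.Relation.Unary.Any using (here; there)
open import Data.Product using (∃; _,_)
open import Data.Sum using (_⊎_; inj₁; inj₂; [_,_]; [_,_]′)
open import Data.Empty using (⊥-elim)
import Data.Empty
open import Function using (_∘_)
open import Function.Bundles using (_⇔_; mk⇔; Equivalence)
open import Function.Definitions using (Surjective)
open Equivalence using (to; from)
open import Level using (0ℓ)
open import Relation.Nullary using (¬_; Dec; yes; no; _×-dec_; ¬?)
open import Relation.Nullary.Decidable using (isYes; toWitness; fromWitness; decidable-stable; toSum)
open import Relation.Unary using (Pred; Decidable)
open import Relation.Binary using (Rel; IsDecEquivalence)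
open import Relation.Binary.PropositionalEquality using (_≢_; refl; sym; trans; cong; cong₂; subst; module ≡-Reasoning)
import Relation.Binary.Construct.On as On
import Induction.WellFounded as WF
open import Algebra.Properties.CommutativeSemigroup *-commutativeSemigroup using (x∙yz≈y∙xz)
open import Algebra.Properties.CommutativeMonoid.Sum +-0-commutativeMonoid using (∑-comm; sum-cong-≗; sum-syntax)

∣p∣+∣q∣≡∣p∪q∣+∣p∩q∣ : ∀ {n} (p q : Subset n) → ∣ p ∣ + ∣ q ∣ ≡ ∣ p ∪ q ∣ + ∣ p ∩ q ∣
∣p∣+∣q∣≡∣p∪q∣+∣p∩q∣ []            []            = refl
∣p∣+∣q∣≡∣p∪q∣+∣p∩q∣ (true  ∷ p) (true  ∷ q) = cong suc (trans (+-suc ∣ p ∣ ∣ q ∣)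
  (trans (cong suc (∣p∣+∣q∣≡∣p∪q∣+∣p∩q∣ p q)) (sym (+-suc ∣ p ∪ q ∣ ∣ p ∩ q ∣))))
∣p∣+∣q∣≡∣p∪q∣+∣p∩q∣ (true  ∷ p) (false ∷ q) = cong suc (∣p∣+∣q∣≡∣p∪q∣+∣p∩q∣ p q)
∣p∣+∣q∣≡∣p∪q∣+∣p∩q∣ (false ∷ p) (true  ∷ q) =
  trans (+-suc ∣ p ∣ ∣ q ∣) (cong suc (∣p∣+∣q∣≡∣p∪q∣+∣p∩q∣ p q))
∣p∣+∣q∣≡∣p∪q∣+∣p∩q∣ (false ∷ p) (false ∷ q) = ∣p∣+∣q∣≡∣p∪q∣+∣p∩q∣ p q

∣p∪q∣≤∣p∣+∣q∣ : ∀ {n} (p q : Subset n) → ∣ p ∪ q ∣ ≤ ∣ p ∣ + ∣ q ∣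
∣p∪q∣≤∣p∣+∣q∣ p q =
  ≤-trans (m≤m+n ∣ p ∪ q ∣ ∣ p ∩ q ∣) (≤-reflexive (sym (∣p∣+∣q∣≡∣p∪q∣+∣p∩q∣ p q)))

disjoint⇒∣p∣+∣q∣≡∣p∪q∣ : ∀ {n} (p q : Subset n) → Empty (p ∩ q) → ∣ p ∣ + ∣ q ∣ ≡ ∣ p ∪ q ∣
disjoint⇒∣p∣+∣q∣≡∣p∪q∣ {n} p q p∩q-empty = begin
  ∣ p ∣ + ∣ q ∣          ≡⟨ ∣p∣+∣q∣≡∣p∪q∣+∣p∩q∣ p q ⟩
  ∣ p ∪ q ∣ + ∣ p ∩ q ∣  ≡⟨ cong (λ s → ∣ p ∪ q ∣ + ∣ s ∣) (Empty-unique p∩q-empty) ⟩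
  ∣ p ∪ q ∣ + ∣ ⊥ {n} ∣  ≡⟨ cong (∣ p ∪ q ∣ +_) (∣⊥∣≡0 n) ⟩
  ∣ p ∪ q ∣ + 0          ≡⟨ +-identityʳ _ ⟩
  ∣ p ∪ q ∣              ∎
  where open ≡-Reasoning

nonempty⇒∣p∣≥1 : ∀ {n} {p : Subset n} → Nonempty p → 1 ≤ ∣ p ∣
nonempty⇒∣p∣≥1 {p = p} (x , x∈p) =
  ≤-trans (≤-reflexive (sym (∣⁅x⁆∣≡1 x)))
          (p⊆q⇒∣p∣≤∣q∣ (λ y∈⁅x⁆ → subst (_∈ p) (sym (x∈⁅y⁆⇒x≡y x y∈⁅x⁆)) x∈p))

∣empty∣≡0 : ∀ {n} {p : Subset n} → Empty p → ∣ p ∣ ≡ 0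
∣empty∣≡0 {n} p-empty = trans (cong ∣_∣ (Empty-unique p-empty)) (∣⊥∣≡0 n)

x∈p─q⇒x∉q : ∀ {n} {x : Fin n} (p q : Subset n) → x ∈ p ─ q → x ∉ q
x∈p─q⇒x∉q (_ ∷ p) (true  ∷ q) (there x∈p─q) (there x∈q) = x∈p─q⇒x∉q p q x∈p─q x∈q
x∈p─q⇒x∉q (_ ∷ p) (false ∷ q) (there x∈p─q) (there x∈q) = x∈p─q⇒x∉q p q x∈p─q x∈q

∈-∩ : ∀ {n} {x : Fin n} (p q : Subset n) → x ∈ p ∩ q ⇔ (x ∈ p × x ∈ q)
∈-∩ p q = mk⇔ (x∈p∩q⁻ p q) x∈p∩q⁺

∈-─ : ∀ {n} {x : Fin n} (p q : Subset n) → x ∈ p ─ q ⇔ (x ∈ p × x ∉ q)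
∈-─ p q = mk⇔ (λ x∈ → p─q⊆p p q x∈ , x∈p─q⇒x∉q p q x∈) (λ (x∈p , x∉q) → x∈p∧x∉q⇒x∈p─q x∈p x∉q)

∈-tabulate : ∀ {n} (f : Fin n → Bool) {x : Fin n} → x ∈ tabulate f ⇔ T (f x)
∈-tabulate f {x} = mk⇔
  (λ x∈ → from T-≡ (trans (sym (lookup∘tabulate f x)) ([]=⇒lookup x∈)))
  (λ fx → lookup⇒[]= x (tabulate f) (trans (lookup∘tabulate f x) (to T-≡ fx)))

select : ∀ {n ℓ} {P : Pred (Fin n) ℓ} → Decidable P → Subset n
select P? = tabulate (λ x → isYes (P? x))

∈-select : ∀ {n ℓ} {P : Pred (Fin n) ℓ} (P? : Decidable P) {x : Fin n} → x ∈ select P? ⇔ P x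
∈-select P? {x} = mk⇔ (λ x∈ → toWitness {a? = P? x} (to (∈-tabulate _) x∈))
                      (λ Px → from (∈-tabulate _) (fromWitness {a? = P? x} Px))

∈⇔T-lookup : ∀ {n} {x : Fin n} {p : Subset n} → x ∈ p ⇔ T (lookup p x)
∈⇔T-lookup {x = x} {p} = mk⇔ (λ x∈p → from T-≡ ([]=⇒lookup x∈p)) (λ t → lookup⇒[]= x p (to T-≡ t))

anyᵇ⇔Nonempty : ∀ {n} (v : Subset n) → T (anyᵇ v) ⇔ Nonempty v
anyᵇ⇔Nonempty v = mk⇔ (sound v) (complete v)
  where
  sound : ∀ {n} (v : Subset n) → T (anyᵇ v) → Nonempty v
  sound (true  ∷ v) _ = zero , here
  sound (false ∷ v) t with sound v t
  ... | x , x∈v = suc x , there x∈v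
  complete : ∀ {n} (v : Subset n) → Nonempty v → T (anyᵇ v)
  complete (true  ∷ v) _                 = _
  complete (false ∷ v) (suc x , there x∈v) = complete v (x , x∈v)

T-not⇔¬T : ∀ {b} → T (not b) ⇔ (¬ T b)
T-not⇔¬T {true}  = mk⇔ (λ ()) (λ ¬t → ¬t _)
T-not⇔¬T {false} = mk⇔ (λ _ ()) (λ _ → _)

subᵇ⇔⊆ : ∀ {n} (e U : Subset n) → T (subᵇ e U) ⇔ e ⊆ U
subᵇ⇔⊆ e U = mk⇔ sound complete
  where
  sound : T (subᵇ e U) → e ⊆ U
  sound t {x} x∈e with x ∈? U
  ... | yes x∈U = x∈U
  ... | no  x∉U = ⊥-elim (to T-not⇔¬T t (from (anyᵇ⇔Nonempty (e ─ U)) (x , x∈p∧x∉q⇒x∈p─q x∈e x∉U)))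
  complete : e ⊆ U → T (subᵇ e U)
  complete e⊆U = from T-not⇔¬T λ t →
    let (x , x∈e─U) = to (anyᵇ⇔Nonempty (e ─ U)) t
    in x∈p─q⇒x∉q e U x∈e─U (e⊆U (p─q⊆p e U x∈e─U))

Crosses : ∀ {n} → Subset n → Subset n → Subset n → Set
Crosses e U A = Nonempty (e ∩ A) × Nonempty (e ∩ (U ─ A))

crossᵇ⇔Crosses : ∀ {n} (e U A : Subset n) → T (crossᵇ e U A) ⇔ Crosses e U A
crossᵇ⇔Crosses e U A = mk⇔
  (λ t → let (t₁ , t₂) = to T-∧ t in to (anyᵇ⇔Nonempty _) t₁ , to (anyᵇ⇔Nonempty _) t₂)
  (λ (c₁ , c₂) → from T-∧ (from (anyᵇ⇔Nonempty _) c₁ , from (anyᵇ⇔Nonempty _) c₂))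

∈-δ : ∀ {n m} (E : Fin m → Subset n) (S : Subset m) (U A : Subset n) {i : Fin m} →
      i ∈ δ E S U A ⇔ (i ∈ S × E i ⊆ U × Crosses (E i) U A)
∈-δ E S U A {i} = mk⇔
  (λ i∈δ → let (s , t) = to T-∧ (to (∈-tabulate _) i∈δ)
               (t₁ , t₂) = to T-∧ t
           in from ∈⇔T-lookup s , (λ {x} → to (subᵇ⇔⊆ (E i) U) t₁ {x}) , to (crossᵇ⇔Crosses (E i) U A) t₂)
  (λ (i∈S , e⊆U , cr) → from (∈-tabulate _)
      (from T-∧ (to ∈⇔T-lookup i∈S ,
                 from T-∧ (from (subᵇ⇔⊆ (E i) U) e⊆U , from (crossᵇ⇔Crosses (E i) U A) cr))))

image : ∀ {a b} → (Fin a → Fin b) → Subset a → Subset b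
image f []          = ⊥
image f (true  ∷ e) = ⁅ f zero ⁆ ∪ image (f ∘ suc) e
image f (false ∷ e) = image (f ∘ suc) e

∈-image : ∀ {a b} (f : Fin a → Fin b) {e : Subset a} {x : Fin a} → x ∈ e → f x ∈ image f e
∈-image f {true  ∷ e} here          = p⊆p∪q (image (f ∘ suc) e) (x∈⁅x⁆ (f zero))
∈-image f {true  ∷ e} (there x∈e)   = q⊆p∪q ⁅ f zero ⁆ (image (f ∘ suc) e) (∈-image (f ∘ suc) x∈e)
∈-image f {false ∷ e} (there x∈e)   = ∈-image (f ∘ suc) x∈e

∣image∣≤∣e∣ : ∀ {a b} (f : Fin a → Fin b) (e : Subset a) → ∣ image f e ∣ ≤ ∣ e ∣
∣image∣≤∣e∣ {b = b} f []  = ≤-reflexive (∣⊥∣≡0 b)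
∣image∣≤∣e∣ f (true  ∷ e) = begin
  ∣ ⁅ f zero ⁆ ∪ image (f ∘ suc) e ∣        ≤⟨ ∣p∪q∣≤∣p∣+∣q∣ ⁅ f zero ⁆ _ ⟩
  ∣ ⁅ f zero ⁆ ∣ + ∣ image (f ∘ suc) e ∣    ≡⟨ cong (_+ ∣ image (f ∘ suc) e ∣) (∣⁅x⁆∣≡1 (f zero)) ⟩
  suc ∣ image (f ∘ suc) e ∣                 ≤⟨ s≤s (∣image∣≤∣e∣ (f ∘ suc) e) ⟩
  suc ∣ e ∣                                 ∎
  where open ≤-Reasoning
∣image∣≤∣e∣ f (false ∷ e) = ∣image∣≤∣e∣ (f ∘ suc) e

-- Cardinality as a sum of indicators, to which the commutativity of
-- double sums applies.
𝟙 : Bool → ℕ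
𝟙 true  = 1
𝟙 false = 0

∣p∣≡∑𝟙 : ∀ {n} (p : Subset n) → ∣ p ∣ ≡ ∑[ x < n ] 𝟙 (lookup p x)
∣p∣≡∑𝟙 []          = refl
∣p∣≡∑𝟙 (true  ∷ p) = cong suc (∣p∣≡∑𝟙 p)
∣p∣≡∑𝟙 (false ∷ p) = ∣p∣≡∑𝟙 p

column : ∀ {a b} → (Fin b → Subset a) → Fin a → Subset b
column D x = tabulate (λ y → lookup (D y) x)

∈-column : ∀ {a b} (D : Fin b → Subset a) {x y} → y ∈ column D x ⇔ x ∈ D y
∈-column D = mk⇔ (from ∈⇔T-lookup ∘ to (∈-tabulate _)) (from (∈-tabulate _) ∘ to ∈⇔T-lookup)

∑∣D∣≡∑∣column∣ : ∀ {a b} (D : Fin b → Subset a) →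
                 ∑[ y < b ] ∣ D y ∣ ≡ ∑[ x < a ] ∣ column D x ∣
∑∣D∣≡∑∣column∣ {a} {b} D = begin
  ∑[ y < b ] ∣ D y ∣                            ≡⟨ sum-cong-≗ (λ y → ∣p∣≡∑𝟙 (D y)) ⟩
  ∑[ y < b ] ∑[ x < a ] 𝟙 (lookup (D y) x)      ≡⟨ ∑-comm (λ y x → 𝟙 (lookup (D y) x)) ⟩
  ∑[ x < a ] ∑[ y < b ] 𝟙 (lookup (D y) x)      ≡⟨ sum-cong-≗ (λ x → sym (column-size x)) ⟩
  ∑[ x < a ] ∣ column D x ∣                     ∎
  where
  open ≡-Reasoning
  column-size : ∀ x → ∣ column D x ∣ ≡ ∑[ y < b ] 𝟙 (lookup (D y) x)
  column-size x = trans (∣p∣≡∑𝟙 (column D x))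
                        (sum-cong-≗ (λ y → cong 𝟙 (lookup∘tabulate (λ y → lookup (D y) x) y)))

∉-there : ∀ {n b} {x : Fin n} {F : Subset n} → x ∉ F → suc x ∉ b ∷ F
∉-there x∉F (there x∈F) = x∉F x∈F

∑≤r*∣support∣ : ∀ {n} (r : ℕ) (f : Fin n → ℕ) (F : Subset n) →
                (∀ x → x ∉ F → f x ≡ 0) → (∀ x → f x ≤ r) → ∑[ x < n ] f x ≤ r * ∣ F ∣
∑≤r*∣support∣ r f []          _    _   = z≤n
∑≤r*∣support∣ r f (true  ∷ F) out f≤r = begin
  f zero + ∑[ x < _ ] f (suc x)    ≤⟨ +-mono-≤ (f≤r zero) (∑≤r*∣support∣ r (f ∘ suc) F (λ x → out (suc x) ∘ ∉-there) (f≤r ∘ suc)) ⟩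
  r + r * ∣ F ∣                     ≡⟨ *-suc r ∣ F ∣ ⟨
  r * suc ∣ F ∣                     ∎
  where open ≤-Reasoning
∑≤r*∣support∣ r f (false ∷ F) out f≤r = begin
  f zero + ∑[ x < _ ] f (suc x)    ≡⟨ cong (_+ ∑[ x < _ ] f (suc x)) (out zero λ ()) ⟩
  ∑[ x < _ ] f (suc x)             ≤⟨ ∑≤r*∣support∣ r (f ∘ suc) F (λ x → out (suc x) ∘ ∉-there) (f≤r ∘ suc) ⟩
  r * ∣ F ∣                        ∎
  where open ≤-Reasoning

t*∣H∣≤∑ : ∀ {n} (t : ℕ) (f : Fin n → ℕ) (H : Subset n) → (∀ x → x ∈ H → t ≤ f x) → t * ∣ H ∣ ≤ ∑[ x < n ] f x
t*∣H∣≤∑ t f []          _     = ≤-reflexive (*-zeroʳ t)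
t*∣H∣≤∑ t f (true  ∷ H) t≤f = begin
  t * suc ∣ H ∣                   ≡⟨ *-suc t ∣ H ∣ ⟩
  t + t * ∣ H ∣                   ≤⟨ +-mono-≤ (t≤f zero here) (t*∣H∣≤∑ t (f ∘ suc) H (λ x → t≤f (suc x) ∘ there)) ⟩
  f zero + ∑[ x < _ ] f (suc x)   ∎
  where open ≤-Reasoning
t*∣H∣≤∑ t f (false ∷ H) t≤f =
  ≤-trans (t*∣H∣≤∑ t (f ∘ suc) H (λ x → t≤f (suc x) ∘ there)) (m≤n+m _ (f zero))

record Quotient {n} (R : Rel (Fin n) 0ℓ) : Set where
  field
    size           : ℕ
    label          : Fin n → Fin size
    label-onto     : ∀ y → ∃ λ x → label x ≡ y
    label-sound    : ∀ {x y} → label x ≡ label y → R x y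
    label-complete : ∀ {x y} → R x y → label x ≡ label y

  size≤n : size ≤ n
  size≤n = injective⇒≤ {f = proj₁ ∘ label-onto} λ {y} {y′} eq →
    trans (sym (proj₂ (label-onto y))) (trans (cong label eq) (proj₂ (label-onto y′)))

module ExtendQuotient {n} {R : Rel (Fin (suc n)) 0ℓ} (isDecEq : IsDecEquivalence R)
                      (Q : Quotient (λ x y → R (suc x) (suc y))) where
  open IsDecEquivalence isDecEq renaming (refl to R-refl; sym to R-sym; trans to R-trans)
  open Quotient Q

  join : ∀ {y₀} → R zero (suc y₀) → Quotient R
  join {y₀} 0Ry₀ = record
    { size = size ; label = label′ ; label-onto = onto ; label-sound = sound ; label-complete = complete }
    where
    label′ : Fin (suc n) → Fin size
    label′ zero    = label y₀
    label′ (suc x) = label x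
    onto : ∀ y → ∃ λ x → label′ x ≡ y
    onto y = let (x , eq) = label-onto y in suc x , eq
    sound : ∀ {x y} → label′ x ≡ label′ y → R x y
    sound {zero}  {zero}  _  = R-refl
    sound {zero}  {suc y} eq = R-trans 0Ry₀ (label-sound eq)
    sound {suc x} {zero}  eq = R-trans (label-sound eq) (R-sym 0Ry₀)
    sound {suc x} {suc y} eq = label-sound eq
    complete : ∀ {x y} → R x y → label′ x ≡ label′ y
    complete {zero}  {zero}  _   = refl
    complete {zero}  {suc y} 0Ry = label-complete (R-trans (R-sym 0Ry₀) 0Ry)
    complete {suc x} {zero}  xR0 = label-complete (R-trans xR0 0Ry₀)
    complete {suc x} {suc y} xRy = label-complete xRy

  fresh : ¬ (∃ λ y → R zero (suc y)) → Quotient R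
  fresh ¬0R = record
    { size = suc size ; label = label′ ; label-onto = onto ; label-sound = sound ; label-complete = complete }
    where
    label′ : Fin (suc n) → Fin (suc size)
    label′ zero    = zero
    label′ (suc x) = suc (label x)
    onto : ∀ y → ∃ λ x → label′ x ≡ y
    onto zero    = zero , refl
    onto (suc y) = let (x , eq) = label-onto y in suc x , cong suc eq
    sound : ∀ {x y} → label′ x ≡ label′ y → R x y
    sound {zero}  {zero}  _  = R-refl
    sound {suc x} {suc y} eq = label-sound (Fin.suc-injective eq)
    complete : ∀ {x y} → R x y → label′ x ≡ label′ y
    complete {zero}  {zero}  _   = refl
    complete {zero}  {suc y} 0Ry = ⊥-elim (¬0R (y , 0Ry))
    complete {suc x} {zero}  xR0 = ⊥-elim (¬0R (x , R-sym xR0))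
    complete {suc x} {suc y} xRy = cong suc (label-complete xRy)

quotient : ∀ {n} {R : Rel (Fin n) 0ℓ} → IsDecEquivalence R → Quotient R
quotient {zero} _ = record
  { size = 0 ; label = λ () ; label-onto = λ () ; label-sound = λ { {()} } ; label-complete = λ { {()} } }
quotient {suc n} {R} isDecEq =
  [ (λ (_ , 0Ry₀) → join 0Ry₀) , fresh ]′ (toSum (any? λ y → zero R? suc y))
  where
  open IsDecEquivalence isDecEq renaming (refl to R-refl; sym to R-sym; trans to R-trans; _≟_ to _R?_)
  restricted : IsDecEquivalence (λ x y → R (suc x) (suc y))
  restricted = record
    { isEquivalence = record { refl = R-refl ; sym = R-sym ; trans = R-trans }
    ; _≟_ = λ x y → suc x R? suc y }
  open ExtendQuotient isDecEq (quotient restricted)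

module _ {n m : ℕ} (E : Fin m → Subset n) where

  Conn-trans : ∀ {S u w v} → Conn E S u w → Conn E S w v → Conn E S u v
  Conn-trans here                      q = q
  Conn-trans (step i i∈S u∈e w∈e p) q = step i i∈S u∈e w∈e (Conn-trans p q)

  Conn-sym : ∀ {S u v} → Conn E S u v → Conn E S v u
  Conn-sym here                     = here
  Conn-sym (step i i∈S u∈e w∈e p) = Conn-trans (Conn-sym p) (step i i∈S w∈e u∈e here)

  Conn-mono : ∀ {S S′ u v} → S ⊆ S′ → Conn E S u v → Conn E S′ u v
  Conn-mono S⊆S′ here                     = here
  Conn-mono S⊆S′ (step i i∈S u∈e w∈e p) = step i (S⊆S′ i∈S) u∈e w∈e (Conn-mono S⊆S′ p)

module _ {n m : ℕ} (E : Fin (suc m) → Subset n) (S : Subset m) where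

  private
    Conn′ : Fin n → Fin n → Set
    Conn′ = Conn (E ∘ suc) S

  Conn-lift : ∀ {b u v} → Conn′ u v → Conn E (b ∷ S) u v
  Conn-lift here                     = here
  Conn-lift (step i i∈S u∈e w∈e p) = step (suc i) (there i∈S) u∈e w∈e (Conn-lift p)

  Conn-drop : ∀ {u v} → Conn E (false ∷ S) u v → Conn′ u v
  Conn-drop here                                   = here
  Conn-drop (step (suc i) (there i∈S) u∈e w∈e p) = step i i∈S u∈e w∈e (Conn-drop p)

  -- A path using edge 0 can be shortcut to: reach edge 0, cross it once, leave it.
  ViaEdge0 : Fin n → Fin n → Set
  ViaEdge0 u v = ∃ λ a → ∃ λ b → a ∈ E zero × b ∈ E zero × Conn′ u a × Conn′ b v

  Conn-split : ∀ {u v} → Conn E (true ∷ S) u v → Conn′ u v ⊎ ViaEdge0 u v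
  Conn-split here = inj₁ here
  Conn-split {u} (step {w = w} zero here u∈e w∈e p) with Conn-split p
  ... | inj₁ w~v                        = inj₂ (u , w , u∈e , w∈e , here , w~v)
  ... | inj₂ (a , b , a∈e , b∈e , _ , b~v) = inj₂ (u , b , u∈e , b∈e , here , b~v)
  Conn-split (step (suc i) (there i∈S) u∈e w∈e p) with Conn-split p
  ... | inj₁ w~v                          = inj₁ (step i i∈S u∈e w∈e w~v)
  ... | inj₂ (a , b , a∈e , b∈e , w~a , b~v) = inj₂ (a , b , a∈e , b∈e , step i i∈S u∈e w∈e w~a , b~v)

  ViaEdge0⇒Conn : ∀ {u v} → ViaEdge0 u v → Conn E (true ∷ S) u v
  ViaEdge0⇒Conn (a , b , a∈e , b∈e , u~a , b~v) =
    Conn-trans E (Conn-lift u~a) (step zero here a∈e b∈e (Conn-lift b~v))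

Conn? : ∀ {n m} (E : Fin m → Subset n) (S : Subset m) u v → Dec (Conn E S u v)
Conn? {m = zero} E [] u v with u Fin.≟ v
... | yes refl = yes here
... | no  u≢v  = no λ { here → u≢v refl ; (step () _ _ _ _) }
Conn? {m = suc m} E (false ∷ S) u v with Conn? (E ∘ suc) S u v
... | yes u~v = yes (Conn-lift E S u~v)
... | no  u≁v = no (u≁v ∘ Conn-drop E S)
Conn? {m = suc m} E (true ∷ S) u v with Conn? (E ∘ suc) S u v | via?
  where
  via? : Dec (ViaEdge0 E S u v)
  via? with any? (λ a → any? (λ b → a ∈? E zero ×-dec b ∈? E zero ×-dec
                                     Conn? (E ∘ suc) S u a ×-dec Conn? (E ∘ suc) S b v))
  ... | yes (a , b , a∈e , b∈e , u~a , b~v) = yes (a , b , a∈e , b∈e , u~a , b~v)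
  ... | no  ¬via = no λ (a , b , rest) → ¬via (a , b , rest)
... | yes u~v | _         = yes (Conn-lift E S u~v)
... | no  _   | yes via   = yes (ViaEdge0⇒Conn E S via)
... | no  u≁v | no  ¬via  = no λ p → [ u≁v , ¬via ] (Conn-split E S p)

components-exist : ∀ {n m} (E : Fin m → Subset n) (S : Subset m) → ∃ λ c → HasComponents E S c
components-exist E S = size , label , onto , λ u v → mk⇔ label-sound label-complete
  where
  Q : Quotient (Conn E S)
  Q = quotient record
    { isEquivalence = record { refl = here ; sym = Conn-sym E ; trans = Conn-trans E }
    ; _≟_ = Conn? E S }
  open Quotient Q
  onto : Surjective _≡_ _≡_ label
  onto y = let (x , eq) = label-onto y in x , λ { refl → eq }

-- Deleting edges cannot decrease the number of components: the components
-- of the larger hypergraph embed into those of the smaller one.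
components-mono : ∀ {n m} (E : Fin m → Subset n) {S S′ : Subset m} {c c′ : ℕ} → S′ ⊆ S →
                  HasComponents E S c → HasComponents E S′ c′ → c ≤ c′
components-mono E S′⊆S (f , f-onto , f-conn) (f′ , _ , f′-conn) = injective⇒≤ {f = f′ ∘ rep} rep-injective
  where
  rep : Fin _ → Fin _
  rep y = proj₁ (f-onto y)
  f∘rep : ∀ y → f (rep y) ≡ y
  f∘rep y = proj₂ (f-onto y) refl
  rep-injective : ∀ {y y′} → f′ (rep y) ≡ f′ (rep y′) → y ≡ y′
  rep-injective {y} {y′} eq = begin
    y             ≡⟨ sym (f∘rep y) ⟩
    f (rep y)     ≡⟨ from (f-conn _ _) (Conn-mono E S′⊆S (to (f′-conn _ _) eq)) ⟩
    f (rep y′)    ≡⟨ f∘rep y′ ⟩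
    y′            ∎
    where open ≡-Reasoning

[c∸b]+[b∸a]≡c∸a : ∀ {a b c} → a ≤ b → b ≤ c → (c ∸ b) + (b ∸ a) ≡ c ∸ a
[c∸b]+[b∸a]≡c∸a {a} {b} {c} a≤b b≤c = begin
  (c ∸ b) + (b ∸ a)   ≡⟨ +-∸-assoc (c ∸ b) a≤b ⟨
  (c ∸ b) + b ∸ a     ≡⟨ cong (_∸ a) (m∸n+n≡m b≤c) ⟩
  c ∸ a               ∎
  where open ≡-Reasoning

module Rounds {n m : ℕ} (E : Fin m → Subset n) (part : PartitionProc E) (t : ℕ) where

  removed : ℕ → Subset m
  removed zero    = ⊥
  removed (suc j) = removed j ∪ part (⊤ ─ removed j) t

  remaining : ℕ → Subset m
  remaining j = ⊤ ─ removed j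

  partition : ℕ → Subset m
  partition j = part (remaining j) t

  remaining-step : ∀ j → remaining (suc j) ≡ remaining j ─ partition j
  remaining-step j = sym (p─q─r≡p─q∪r ⊤ (removed j) (partition j))

  remaining-shrinks : ∀ j → remaining (suc j) ⊆ remaining j
  remaining-shrinks j rewrite remaining-step j = p─q⊆p (remaining j) (partition j)

  weakLoop-rounds : ∀ j i c → weakLoop E part t j (remaining i) (removed i) c ≡ (removed (j + i) , j + c)
  weakLoop-rounds zero    i c = refl
  weakLoop-rounds (suc j) i c = begin
    weakLoop E part t j (remaining i ─ removed (suc i)) (removed (suc i)) (suc c)
      ≡⟨ cong (λ S → weakLoop E part t j S (removed (suc i)) (suc c)) remove-again ⟩
    weakLoop E part t j (remaining (suc i)) (removed (suc i)) (suc c)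
      ≡⟨ weakLoop-rounds j (suc i) (suc c) ⟩
    (removed (j + suc i) , j + suc c)
      ≡⟨ cong₂ _,_ (cong removed (+-suc j i)) (+-suc j c) ⟩
    (removed (suc j + i) , suc j + c)  ∎
    where
    open ≡-Reasoning
    remove-again : remaining i ─ removed (suc i) ≡ remaining (suc i)
    remove-again = begin
      (⊤ ─ removed i) ─ (removed i ∪ partition i)    ≡⟨ p─q─r≡p─q∪r ⊤ (removed i) _ ⟩
      ⊤ ─ (removed i ∪ (removed i ∪ partition i))  ≡⟨ cong (⊤ ─_) (sym (∪-assoc (removed i) _ _)) ⟩
      ⊤ ─ ((removed i ∪ removed i) ∪ partition i)  ≡⟨ cong (λ X → ⊤ ─ (X ∪ partition i)) (∪-idem (removed i)) ⟩
      ⊤ ─ (removed i ∪ partition i)                ∎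

  weakLoop-from-start : ∀ J → weakLoop E part t J ⊤ ⊥ 0 ≡ (removed J , J)
  weakLoop-from-start J = begin
    weakLoop E part t J ⊤ ⊥ 0                ≡⟨ cong (λ S → weakLoop E part t J S ⊥ 0) (sym (p─⊥≡p ⊤)) ⟩
    weakLoop E part t J (remaining 0) ⊥ 0    ≡⟨ weakLoop-rounds J 0 0 ⟩
    (removed (J + 0) , J + 0)                ≡⟨ cong₂ _,_ (cong removed (+-identityʳ J)) (+-identityʳ J) ⟩
    (removed J , J)                          ∎
    where open ≡-Reasoning

  -- The union of 2t-light partitions of successive hypergraphs is 2t-light
  -- for the input: the bounds telescope over the component counts.
  removed-light : PartitionSpec E part → ∀ j → Light E ⊤ (2 * t) (removed j)
  removed-light spec zero    c₀ c _ _ = ≤-trans (≤-reflexive (∣⊥∣≡0 m)) z≤n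
  removed-light spec (suc j) c₀ c′ comps₀ comps′ = begin
    ∣ removed j ∪ partition j ∣                  ≤⟨ ∣p∪q∣≤∣p∣+∣q∣ (removed j) (partition j) ⟩
    ∣ removed j ∣ + ∣ partition j ∣              ≤⟨ +-mono-≤ removed-bound partition-bound ⟩
    2 * t * (c ∸ c₀) + 2 * t * (c′ ∸ c)          ≡⟨ sym (*-distribˡ-+ (2 * t) (c ∸ c₀) (c′ ∸ c)) ⟩
    2 * t * ((c ∸ c₀) + (c′ ∸ c))                ≡⟨ cong (2 * t *_) (trans (+-comm (c ∸ c₀) _) ([c∸b]+[b∸a]≡c∸a c₀≤c c≤c′)) ⟩
    2 * t * (c′ ∸ c₀)                            ∎
    where
    open ≤-Reasoning
    c : ℕ
    c = proj₁ (components-exist E (remaining j))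
    comps : HasComponents E (remaining j) c
    comps = proj₂ (components-exist E (remaining j))
    comps-after : HasComponents E (remaining j ─ partition j) c′
    comps-after = subst (λ S → HasComponents E S c′) (remaining-step j) comps′
    removed-bound : ∣ removed j ∣ ≤ 2 * t * (c ∸ c₀)
    removed-bound = removed-light spec j c₀ c comps₀ comps
    partition-bound : ∣ partition j ∣ ≤ 2 * t * (c′ ∸ c)
    partition-bound = proj₂ (spec (remaining j) t) c c′ comps comps-after
    c₀≤c : c₀ ≤ c
    c₀≤c = components-mono E ⊆⊤ comps₀ comps
    c≤c′ : c ≤ c′
    c≤c′ = components-mono E (remaining-shrinks j) comps comps′

cut-restrict : ∀ {n m} (E : Fin m → Subset n) (S : Subset m) {Z U : Subset n} (A : Subset n) →
               Z ⊆ U → cutSize E S Z (A ∩ Z) ≤ cutSize E S U A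
cut-restrict E S {Z} {U} A Z⊆U = p⊆q⇒∣p∣≤∣q∣ λ i∈δ →
  let (i∈S , e⊆Z , (x , x∈e∩A∩Z) , (y , y∈e∩Z─A∩Z)) = to (∈-δ E S Z (A ∩ Z)) i∈δ
      (x∈e , x∈A∩Z) = to (∈-∩ _ _) x∈e∩A∩Z
      (y∈e , y∈Z─A∩Z) = to (∈-∩ _ _) y∈e∩Z─A∩Z
      (y∈Z , y∉A∩Z) = to (∈-─ Z (A ∩ Z)) y∈Z─A∩Z
      y∉A = λ y∈A → y∉A∩Z (from (∈-∩ A Z) (y∈A , y∈Z))
  in from (∈-δ E S U A)
       ( i∈S , ⊆-trans e⊆Z Z⊆U
       , (x , from (∈-∩ _ A) (x∈e , proj₁ (to (∈-∩ A Z) x∈A∩Z)))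
       , (y , from (∈-∩ _ (U ─ A)) (y∈e , from (∈-─ U A) (Z⊆U y∈Z , y∉A))))

light-cut-restricts : ∀ {n m} (E : Fin m → Subset n) {k : ℕ} {Z U A : Subset n} {x y : Fin n} →
                      Z ⊆ U → x ∈ Z → x ∈ A → y ∈ Z → y ∉ A → cutSize E ⊤ U A < k → LambdaLt E ⊤ Z k
light-cut-restricts E {A = A} Z⊆U x∈Z x∈A y∈Z y∉A light =
  A ∩ _ , p∩q⊆q A _ , (_ , from (∈-∩ A _) (x∈A , x∈Z)) , (_ , y∈Z , y∉A ∘ p∩q⊆p A _) ,
  ≤-<-trans (cut-restrict E ⊤ A Z⊆U) light

inside-or-crossing : ∀ {n} {e U : Subset n} (A : Subset n) → e ⊆ U → e ⊆ A ⊎ e ⊆ U ─ A ⊎ Crosses e U A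
inside-or-crossing {e = e} {U} A e⊆U with nonempty? (e ∩ A) | nonempty? (e ∩ (U ─ A))
... | yes meets-A | yes meets-rest = inj₂ (inj₂ (meets-A , meets-rest))
... | no  misses-A | _ = inj₂ (inj₁ λ x∈e →
        from (∈-─ U A) (e⊆U x∈e , λ x∈A → misses-A (_ , from (∈-∩ e A) (x∈e , x∈A))))
... | yes _ | no misses-rest = inj₁ λ {x} x∈e → decidable-stable (x ∈? A) λ x∉A →
        misses-rest (x , from (∈-∩ e (U ─ A)) (x∈e , from (∈-─ U A) (e⊆U x∈e , x∉A)))

m*x<m⇒x≡0 : ∀ m x → m * x < m → x ≡ 0
m*x<m⇒x≡0 m zero    _     = refl
m*x<m⇒x≡0 m (suc x) mx<m = ⊥-elim (<⇒≱ mx<m (m≤m*n m (suc x)))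

-- "f ≤ k (b - 1) unless f = 0": the bound on the number f of edges between
-- b classes that the splitting argument maintains.
Sparse : ℕ → ℕ → ℕ → Set
Sparse k f b = f + k ≤ k * b ⊎ f ≡ 0

sparse-+ : ∀ {k a b α β} → Sparse k a α → Sparse k b β → Sparse k (a + b) (α + β)
sparse-+ {k} {a} {b} {α} {β} (inj₁ a-sparse) (inj₁ b-sparse) = inj₁ (begin
  a + b + k          ≤⟨ +-monoʳ-≤ (a + b) (m≤n+m k k) ⟩
  a + b + (k + k)    ≡⟨ solve 4 (λ a b k l → a :+ b :+ (k :+ l) := (a :+ k) :+ (b :+ l)) refl a b k k ⟩
  (a + k) + (b + k)  ≤⟨ +-mono-≤ a-sparse b-sparse ⟩
  k * α + k * β      ≡⟨ *-distribˡ-+ k α β ⟨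
  k * (α + β)        ∎)
  where open ≤-Reasoning
sparse-+ {k} {a} {α = α} {β} (inj₁ a-sparse) (inj₂ refl) =
  inj₁ (≤-trans (≤-reflexive (cong (_+ k) (+-identityʳ a))) (≤-trans a-sparse (*-monoʳ-≤ k (m≤m+n α β))))
sparse-+ {k} {α = α} {β} (inj₂ refl) (inj₁ b-sparse) = inj₁ (≤-trans b-sparse (*-monoʳ-≤ k (m≤n+m β α)))
sparse-+ (inj₂ refl) (inj₂ refl) = inj₂ refl

sparse-nonzero : ∀ {k a α} → Sparse k a α → 1 ≤ a → a + k ≤ k * α
sparse-nonzero (inj₁ a-sparse) _   = a-sparse
sparse-nonzero (inj₂ refl)     ()

sparse-raise : ∀ {k a α α′} → Sparse k a α → α ≤ α′ → 1 ≤ α′ → a + k ≤ k * α′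
sparse-raise {k} (inj₁ a-sparse) α≤α′ _     = ≤-trans a-sparse (*-monoʳ-≤ k α≤α′)
sparse-raise {k} (inj₂ refl)     _    1≤α′ = ≤-trans (≤-reflexive (sym (*-identityʳ k))) (*-monoʳ-≤ k 1≤α′)

-- The counting step of the splitting argument: f edges inside U split into a
-- edges inside A, b inside U ∖ A and x ≤ k crossing edges; the classes met
-- on the two sides, α′ and β′ of them, are disjoint, and if some edge crosses
-- then both sides meet a class.
sparse-combine : ∀ {k f a b x α β α′ β′ B} →
  f ≤ a + (b + x) → 1 ≤ f → x ≤ k → Sparse k a α → Sparse k b β →
  α ≤ α′ → β ≤ β′ → α′ + β′ ≤ B → x ≡ 0 ⊎ (1 ≤ α′ × 1 ≤ β′) → f + k ≤ k * B
sparse-combine {k} {f} {a} {b} {α = α} {β} {B = B} f≤ 1≤f _ a-sparse b-sparse α≤α′ β≤β′ α′+β′≤B (inj₁ refl) = begin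
  f + k              ≤⟨ +-monoˡ-≤ k f≤a+b ⟩
  a + b + k          ≤⟨ sparse-nonzero (sparse-+ a-sparse b-sparse) (≤-trans 1≤f f≤a+b) ⟩
  k * (α + β)        ≤⟨ *-monoʳ-≤ k (≤-trans (+-mono-≤ α≤α′ β≤β′) α′+β′≤B) ⟩
  k * B              ∎
  where
  open ≤-Reasoning
  f≤a+b : f ≤ a + b
  f≤a+b = ≤-trans f≤ (≤-reflexive (cong (a +_) (+-identityʳ b)))
sparse-combine {k} {f} {a} {b} {x} {α′ = α′} {β′} {B} f≤ _ x≤k a-sparse b-sparse α≤α′ β≤β′ α′+β′≤B (inj₂ (1≤α′ , 1≤β′)) = begin
  f + k              ≤⟨ +-monoˡ-≤ k f≤ ⟩
  a + (b + x) + k    ≤⟨ +-monoˡ-≤ k (+-monoʳ-≤ a (+-monoʳ-≤ b x≤k)) ⟩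
  a + (b + k) + k    ≡⟨ solve 3 (λ a b k → a :+ (b :+ k) :+ k := (a :+ k) :+ (b :+ k)) refl a b k ⟩
  (a + k) + (b + k)  ≤⟨ +-mono-≤ (sparse-raise a-sparse α≤α′ 1≤α′) (sparse-raise b-sparse β≤β′ 1≤β′) ⟩
  k * α′ + k * β′    ≡⟨ *-distribˡ-+ k α′ β′ ⟨
  k * (α′ + β′)      ≤⟨ *-monoʳ-≤ k α′+β′≤B ⟩
  k * B              ∎
  where open ≤-Reasoning

-- The k-strong classes of H = (E , ⊤): u ≈ v when some vertex set Z ∋ u, v
-- has λ(H[Z]) ≥ k.  The k-weak edges are exactly those meeting two classes.
module StrongClasses {n m : ℕ} (E : Fin m → Subset n) (k : ℕ) where

  KConnected : Subset n → Set
  KConnected U = ¬ LambdaLt E ⊤ U k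

  LambdaLt? : ∀ U → Dec (LambdaLt E ⊤ U k)
  LambdaLt? U = anySubset? λ A → A ⊆? U ×-dec nonempty? A ×-dec
                  any? (λ v → v ∈? U ×-dec ¬? (v ∈? A)) ×-dec cutSize E ⊤ U A <? k

  -- Two overlapping k-connected sets have a k-connected union: a light cut
  -- of the union splits one of them, since the common vertex lies on one side.
  KConnected-∪ : ∀ {Z₁ Z₂ w} → KConnected Z₁ → KConnected Z₂ → w ∈ Z₁ → w ∈ Z₂ → KConnected (Z₁ ∪ Z₂)
  KConnected-∪ {Z₁} {Z₂} {w} conn₁ conn₂ w∈Z₁ w∈Z₂ (A , A⊆Z , (a , a∈A) , (v , v∈Z , v∉A) , light) =
    [ (λ w∈A → [ (λ v∈Z₁ → cut conn₁ (p⊆p∪q Z₂) w∈Z₁ w∈A v∈Z₁ v∉A)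
               , (λ v∈Z₂ → cut conn₂ (q⊆p∪q Z₁ Z₂) w∈Z₂ w∈A v∈Z₂ v∉A) ]′ (x∈p∪q⁻ Z₁ Z₂ v∈Z))
    , (λ w∉A → [ (λ a∈Z₁ → cut conn₁ (p⊆p∪q Z₂) a∈Z₁ a∈A w∈Z₁ w∉A)
               , (λ a∈Z₂ → cut conn₂ (q⊆p∪q Z₁ Z₂) a∈Z₂ a∈A w∈Z₂ w∉A) ]′ (x∈p∪q⁻ Z₁ Z₂ (A⊆Z a∈A)))
    ]′ (toSum (w ∈? A))
    where
    cut : ∀ {Z x y} → KConnected Z → Z ⊆ Z₁ ∪ Z₂ → x ∈ Z → x ∈ A → y ∈ Z → y ∉ A → Data.Empty.⊥
    cut conn Z⊆ x∈Z x∈A y∈Z y∉A = conn (light-cut-restricts E Z⊆ x∈Z x∈A y∈Z y∉A light)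

  _≈_ : Fin n → Fin n → Set
  u ≈ v = ∃ λ Z → u ∈ Z × v ∈ Z × KConnected Z

  KConnected-⁅⁆ : ∀ u → KConnected ⁅ u ⁆
  KConnected-⁅⁆ u (A , A⊆⁅u⁆ , (a , a∈A) , (v , v∈⁅u⁆ , v∉A) , _) =
    v∉A (subst (_∈ A) (trans (x∈⁅y⁆⇒x≡y u (A⊆⁅u⁆ a∈A)) (sym (x∈⁅y⁆⇒x≡y u v∈⁅u⁆))) a∈A)

  ≈-isDecEquivalence : IsDecEquivalence _≈_
  ≈-isDecEquivalence = record
    { isEquivalence = record
      { refl  = λ {u} → ⁅ u ⁆ , x∈⁅x⁆ u , x∈⁅x⁆ u , KConnected-⁅⁆ u
      ; sym   = λ (Z , u∈Z , v∈Z , conn) → Z , v∈Z , u∈Z , conn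
      ; trans = λ (Z₁ , u∈Z₁ , v∈Z₁ , conn₁) (Z₂ , v∈Z₂ , w∈Z₂ , conn₂) →
                  Z₁ ∪ Z₂ , p⊆p∪q Z₂ u∈Z₁ , q⊆p∪q Z₁ Z₂ w∈Z₂ , KConnected-∪ conn₁ conn₂ v∈Z₁ v∈Z₂ }
    ; _≟_ = λ u v → anySubset? λ Z → u ∈? Z ×-dec v ∈? Z ×-dec ¬? (LambdaLt? Z) }

  open Quotient (quotient ≈-isDecEquivalence) public
    using () renaming (size to c; label to cls; label-sound to cls-sound; label-complete to cls-complete; size≤n to c≤n)

  Class : Fin c → Subset n
  Class y = select (λ v → cls v Fin.≟ y)

  ∈-Class : ∀ {y v} → v ∈ Class y ⇔ cls v ≡ y
  ∈-Class = ∈-select _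

  Saturated : Subset n → Set
  Saturated U = ∀ {u v} → u ∈ U → cls u ≡ cls v → v ∈ U

  -- A light cut of a saturated set never separates two vertices of a class:
  -- their common k-connected witness Z lies inside U and would be cut.
  light-cut-saturated : ∀ {U A} → Saturated U → A ⊆ U → cutSize E ⊤ U A < k → Saturated A
  light-cut-saturated {U} {A} U-sat A⊆U light {u} {v} u∈A same = decidable-stable (v ∈? A) λ v∉A →
    let (Z , u∈Z , v∈Z , conn) = cls-sound same
        Z⊆U : Z ⊆ U
        Z⊆U z∈Z = U-sat (A⊆U u∈A) (cls-complete (Z , u∈Z , z∈Z , conn))
    in conn (light-cut-restricts E Z⊆U u∈Z u∈A v∈Z v∉A light)

  ─-saturated : ∀ {U A} → Saturated U → Saturated A → Saturated (U ─ A)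
  ─-saturated {U} {A} U-sat A-sat u∈U─A same =
    let (u∈U , u∉A) = to (∈-─ U A) u∈U─A
    in from (∈-─ U A) (U-sat u∈U same , λ v∈A → u∉A (A-sat v∈A (sym same)))

  Class-saturated : ∀ y → Saturated (Class y)
  Class-saturated y u∈Class same = from ∈-Class (trans (sym same) (to ∈-Class u∈Class))

  Class-KConnected : ∀ y → KConnected (Class y)
  Class-KConnected y (A , A⊆Class , (a , a∈A) , (b , b∈Class , b∉A) , light) =
    b∉A (light-cut-saturated (Class-saturated y) A⊆Class light a∈A
          (trans (to ∈-Class (A⊆Class a∈A)) (sym (to ∈-Class b∈Class))))

  ClassCross : Fin m → Fin c → Set
  ClassCross i y = (∃ λ a → a ∈ E i × cls a ≡ y) × (∃ λ b → b ∈ E i × cls b ≢ y)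

  ClassCross? : ∀ i y → Dec (ClassCross i y)
  ClassCross? i y = any? (λ a → a ∈? E i ×-dec cls a Fin.≟ y) ×-dec
                    any? (λ b → b ∈? E i ×-dec ¬? (cls b Fin.≟ y))

  ClassCross⇔Crosses : ∀ {i y} → ClassCross i y ⇔ Crosses (E i) ⊤ (Class y)
  ClassCross⇔Crosses {i} {y} = mk⇔
    (λ ((a , a∈e , a-in) , (b , b∈e , b-out)) →
        (a , from (∈-∩ _ _) (a∈e , from ∈-Class a-in)) ,
        (b , from (∈-∩ _ _) (b∈e , from (∈-─ ⊤ _) (∈⊤ , b-out ∘ to ∈-Class))))
    (λ ((a , a∈e∩Class) , (b , b∈e∩rest)) →
        let (a∈e , a∈Class) = to (∈-∩ _ _) a∈e∩Class
            (b∈e , b∈rest) = to (∈-∩ _ _) b∈e∩rest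
        in (a , a∈e , to ∈-Class a∈Class) , (b , b∈e , proj₂ (to (∈-─ ⊤ _) b∈rest) ∘ from ∈-Class))

  -- An edge meeting two classes is k-weak: any U ⊇ e with λ(H[U]) ≥ k would
  -- put the two classes together.
  crossing⇒weak : ∀ {i y} → ClassCross i y → Weak E ⊤ k i
  crossing⇒weak ((a , a∈e , a-in) , (b , b∈e , b-out)) U e⊆U with LambdaLt? U
  ... | yes λ<k = λ<k
  ... | no  λ≥k = ⊥-elim (b-out (trans (sym (cls-complete (U , e⊆U a∈e , e⊆U b∈e , λ≥k))) a-in))

  -- A nonempty k-weak edge meets two classes, since each class is k-connected.
  weak⇒crossing : ∀ {i} → Nonempty (E i) → Weak E ⊤ k i → ∃ λ y → ClassCross i y
  weak⇒crossing {i} (a , a∈e) weak with any? (λ b → b ∈? E i ×-dec ¬? (cls b Fin.≟ cls a))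
  ... | yes other = cls a , (a , a∈e , refl) , other
  ... | no  none  = ⊥-elim (Class-KConnected (cls a) (weak (Class (cls a)) e⊆Class))
    where
    e⊆Class : E i ⊆ Class (cls a)
    e⊆Class {x} x∈e = from ∈-Class (decidable-stable (cls x Fin.≟ cls a) λ ne → none (x , x∈e , ne))

  InterEdge : Subset m → Subset n → Fin m → Set
  InterEdge S U i = i ∈ S × E i ⊆ U × ∃ (ClassCross i)

  interEdges : Subset m → Subset n → Subset m
  interEdges S U = select λ i → i ∈? S ×-dec E i ⊆? U ×-dec any? (ClassCross? i)

  ∈-interEdges : ∀ {S U i} → i ∈ interEdges S U ⇔ InterEdge S U i
  ∈-interEdges = ∈-select _

  Touched : Subset m → Subset n → Fin c → Set
  Touched S U y = ∃ λ i → i ∈ interEdges S U × ClassCross i y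

  Touched? : ∀ S U y → Dec (Touched S U y)
  Touched? S U y = any? λ i → i ∈? interEdges S U ×-dec ClassCross? i y

  touched : Subset m → Subset n → Subset c
  touched S U = select (Touched? S U)

  ∈-touched : ∀ {S U y} → y ∈ touched S U ⇔ Touched S U y
  ∈-touched = ∈-select _

  TouchedIn : Subset m → Subset n → Subset n → Fin c → Set
  TouchedIn S U Z y = Touched S U y × ∃ λ v → v ∈ Z × cls v ≡ y

  touchedIn : Subset m → Subset n → Subset n → Subset c
  touchedIn S U Z = select λ y → Touched? S U y ×-dec any? λ v → v ∈? Z ×-dec cls v Fin.≟ y

  ∈-touchedIn : ∀ {S U Z y} → y ∈ touchedIn S U Z ⇔ TouchedIn S U Z y
  ∈-touchedIn = ∈-select _

  interEdges-mono : ∀ {S Z U} → Z ⊆ U → interEdges S Z ⊆ interEdges S U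
  interEdges-mono Z⊆U i∈ =
    let (i∈S , e⊆Z , inter) = to ∈-interEdges i∈
    in from ∈-interEdges (i∈S , (λ {x} → ⊆-trans e⊆Z Z⊆U {x}) , inter)

  touched⊆touchedIn : ∀ {S Z U} → Z ⊆ U → touched S Z ⊆ touchedIn S U Z
  touched⊆touchedIn Z⊆U y∈ =
    let (i , i∈F , (a , a∈e , a-in) , other) = to ∈-touched y∈
        (_ , e⊆Z , _) = to ∈-interEdges i∈F
    in from ∈-touchedIn ((i , interEdges-mono Z⊆U i∈F , (a , a∈e , a-in) , other) , (a , e⊆Z a∈e , a-in))

  touchedIn⊆touched : ∀ {S U Z} → touchedIn S U Z ⊆ touched S U
  touchedIn⊆touched y∈ = from ∈-touched (proj₁ (to ∈-touchedIn y∈))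

  module Split (S : Subset m) {U A : Subset n} (U-sat : Saturated U) (A⊆U : A ⊆ U)
               (light : cutSize E ⊤ U A < k) where

    A-sat : Saturated A
    A-sat = light-cut-saturated U-sat A⊆U light

    crossing : Subset m
    crossing = interEdges S U ∩ δ E ⊤ U A

    cover : interEdges S U ⊆ interEdges S A ∪ (interEdges S (U ─ A) ∪ crossing)
    cover {i} i∈F = by-position (to ∈-interEdges i∈F)
      where
      by-position : InterEdge S U i → i ∈ interEdges S A ∪ (interEdges S (U ─ A) ∪ crossing)
      by-position (i∈S , e⊆U , inter) =
        [ (λ (e⊆A : E i ⊆ A) → p⊆p∪q (interEdges S (U ─ A) ∪ crossing)
                                  (from ∈-interEdges (i∈S , (λ {x} → e⊆A {x}) , inter)))
        , [ (λ (e⊆rest : E i ⊆ U ─ A) → q⊆p∪q (interEdges S A) (interEdges S (U ─ A) ∪ crossing)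
                      (p⊆p∪q crossing (from ∈-interEdges (i∈S , (λ {x} → e⊆rest {x}) , inter))))
          , (λ crosses → q⊆p∪q (interEdges S A) (interEdges S (U ─ A) ∪ crossing)
                      (q⊆p∪q (interEdges S (U ─ A)) crossing
                        (from (∈-∩ (interEdges S U) (δ E ⊤ U A))
                              (i∈F , from (∈-δ E ⊤ U A) (∈⊤ , (λ {x} → e⊆U {x}) , crosses))))) ] ]
        (inside-or-crossing A e⊆U)

    ∣crossing∣≤k : ∣ crossing ∣ ≤ k
    ∣crossing∣≤k = <⇒≤ (≤-<-trans (p⊆q⇒∣p∣≤∣q∣ (p∩q⊆q (interEdges S U) (δ E ⊤ U A))) light)

    sides-disjoint : Empty (touchedIn S U A ∩ touchedIn S U (U ─ A))
    sides-disjoint (y , y∈both) =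
      let (y∈A-side , y∈rest-side) = to (∈-∩ _ _) y∈both
          (_ , (v , v∈A , v-in)) = to ∈-touchedIn y∈A-side
          (_ , (w , w∈rest , w-in)) = to ∈-touchedIn y∈rest-side
      in proj₂ (to (∈-─ U A) w∈rest) (A-sat v∈A (trans v-in (sym w-in)))

    crossing⇒both-sides : Nonempty crossing → 1 ≤ ∣ touchedIn S U A ∣ × 1 ≤ ∣ touchedIn S U (U ─ A) ∣
    crossing⇒both-sides (i , i∈crossing) =
      let (i∈F , i∈δ) = to (∈-∩ _ _) i∈crossing
          (_ , _ , (x , x∈e∩A) , (z , z∈e∩rest)) = to (∈-δ E ⊤ U A) i∈δ
          (x∈e , x∈A) = to (∈-∩ _ _) x∈e∩A
          (z∈e , z∈rest) = to (∈-∩ _ _) z∈e∩rest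
          z∉A = proj₂ (to (∈-─ U A) z∈rest)
          x-side : ClassCross i (cls x)
          x-side = (x , x∈e , refl) , (z , z∈e , λ same → z∉A (A-sat x∈A (sym same)))
          z-side : ClassCross i (cls z)
          z-side = (z , z∈e , refl) , (x , x∈e , λ same → z∉A (A-sat x∈A same))
      in nonempty⇒∣p∣≥1 (cls x , from ∈-touchedIn ((i , i∈F , x-side) , (x , x∈A , refl))) ,
         nonempty⇒∣p∣≥1 (cls z , from ∈-touchedIn ((i , i∈F , z-side) , (z , z∈rest , refl)))

    edges-split : ∣ interEdges S U ∣ ≤ ∣ interEdges S A ∣ + (∣ interEdges S (U ─ A) ∣ + ∣ crossing ∣)
    edges-split = ≤-trans (p⊆q⇒∣p∣≤∣q∣ cover)
      (≤-trans (∣p∪q∣≤∣p∣+∣q∣ (interEdges S A) (interEdges S (U ─ A) ∪ crossing))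
               (+-monoʳ-≤ ∣ interEdges S A ∣ (∣p∪q∣≤∣p∣+∣q∣ (interEdges S (U ─ A)) crossing)))

    classes-split : ∣ touchedIn S U A ∣ + ∣ touchedIn S U (U ─ A) ∣ ≤ ∣ touched S U ∣
    classes-split = ≤-trans (≤-reflexive (disjoint⇒∣p∣+∣q∣≡∣p∪q∣ (touchedIn S U A) (touchedIn S U (U ─ A)) sides-disjoint))
      (p⊆q⇒∣p∣≤∣q∣ λ y∈ → [ touchedIn⊆touched , touchedIn⊆touched ]′ (x∈p∪q⁻ (touchedIn S U A) (touchedIn S U (U ─ A)) y∈))

    crossing-cases : ∣ crossing ∣ ≡ 0 ⊎ (1 ≤ ∣ touchedIn S U A ∣ × 1 ≤ ∣ touchedIn S U (U ─ A) ∣)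
    crossing-cases = [ inj₂ ∘ crossing⇒both-sides , inj₁ ∘ ∣empty∣≡0 ]′ (toSum (nonempty? crossing))

    A-classes : ∣ touched S A ∣ ≤ ∣ touchedIn S U A ∣
    A-classes = p⊆q⇒∣p∣≤∣q∣ {p = touched S A} {q = touchedIn S U A} (touched⊆touchedIn {S} {A} {U} A⊆U)

    rest-classes : ∣ touched S (U ─ A) ∣ ≤ ∣ touchedIn S U (U ─ A) ∣
    rest-classes = p⊆q⇒∣p∣≤∣q∣ {p = touched S (U ─ A)} {q = touchedIn S U (U ─ A)}
                     (touched⊆touchedIn {S} {U ─ A} {U} (p─q⊆p U A))

    split : Sparse k ∣ interEdges S A ∣ ∣ touched S A ∣ →
            Sparse k ∣ interEdges S (U ─ A) ∣ ∣ touched S (U ─ A) ∣ →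
            Nonempty (interEdges S U) → ∣ interEdges S U ∣ + k ≤ k * ∣ touched S U ∣
    split A-sparse rest-sparse some-edge =
      sparse-combine edges-split (nonempty⇒∣p∣≥1 some-edge) ∣crossing∣≤k A-sparse rest-sparse
                     A-classes rest-classes classes-split crossing-cases

  -- The inter-class edges inside a saturated U number at most k (b - 1),
  -- b the number of classes they touch: a light cut exists as soon as one
  -- such edge does, and it splits U into smaller saturated pieces.
  sparse : ∀ (S : Subset m) {U} → Saturated U → Sparse k ∣ interEdges S U ∣ ∣ touched S U ∣
  sparse S {U} = wfRec (λ U → Saturated U → Sparse k ∣ interEdges S U ∣ ∣ touched S U ∣) split-or-empty U
    where
    open WF.All (On.wellFounded ∣_∣ <-wellFounded) 0ℓ using (wfRec)
    split-or-empty : ∀ U → (∀ {V} → ∣ V ∣ < ∣ U ∣ → Saturated V → Sparse k ∣ interEdges S V ∣ ∣ touched S V ∣) →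
           Saturated U → Sparse k ∣ interEdges S U ∣ ∣ touched S U ∣
    split-or-empty U smaller U-sat =
      [ (λ (_ , i∈F) → inj₁ (split-at i∈F)) , inj₂ ∘ ∣empty∣≡0 ]′ (toSum (nonempty? (interEdges S U)))
      where
      split-at : ∀ {i} → i ∈ interEdges S U → ∣ interEdges S U ∣ + k ≤ k * ∣ touched S U ∣
      split-at i∈F =
        let (_ , e⊆U , (_ , cross)) = to ∈-interEdges i∈F
            (A , A⊆U , (a , a∈A) , (v , v∈U , v∉A) , light) = crossing⇒weak cross U e⊆U
            open Split S U-sat A⊆U light
        in split (smaller (p⊂q⇒∣p∣<∣q∣ (A⊆U , v , v∈U , v∉A)) A-sat)
                 (smaller (p∩q≢∅⇒∣p─q∣<∣p∣ U A (a , from (∈-∩ U A) (A⊆U a∈A , a∈A))) (─-saturated U-sat A-sat))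
                 (_ , i∈F)

edge-size≤rank : ∀ {n m} (E : Fin m → Subset n) (i : Fin m) → ∣ E i ∣ ≤ rank E
edge-size≤rank {m = m} E i = ≤-max (∈-map⁺ (λ i → ∣ E i ∣) (∈-allFin i))
  where
  ≤-max : ∀ {xs : List ℕ} {x} → x ∈ₗ xs → x ≤ List.foldr _⊔_ 0 xs
  ≤-max (here refl)  = m≤m⊔n _ _
  ≤-max (there x∈xs) = ≤-trans (≤-max x∈xs) (m≤n⊔m _ _)

-- One run of WeakEdges with threshold t = 2rk, tracked through the number
-- of k-strong classes still touched by inter-class edges.
module Halving {n m : ℕ} (E : Fin m → Subset n) (r k : ℕ) (rank≡r : rank E ≡ r) (1≤k : 1 ≤ k)
               (part : PartitionProc E) (spec : PartitionSpec E part) where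

  open StrongClasses E k

  t : ℕ
  t = 2 * r * k

  open Rounds E part t

  live : ℕ → Subset m
  live j = interEdges (remaining j) ⊤

  active : ℕ → Subset c
  active j = touched (remaining j) ⊤

  degree : ℕ → Fin c → ℕ
  degree j y = cutSize E (remaining j) ⊤ (Class y)

  heavy : ℕ → Subset c
  heavy j = select λ y → y ∈? active j ×-dec t ≤? degree j y

  ∈-heavy : ∀ {j y} → y ∈ heavy j ⇔ (y ∈ active j × t ≤ degree j y)
  ∈-heavy = ∈-select _

  heavy⊆active : ∀ j → heavy j ⊆ active j
  heavy⊆active j y∈ = proj₁ (to (∈-heavy {j}) y∈)

  -- An edge surviving round j only crosses classes of degree ≥ t: otherwise
  -- it would be t-crisp, hence in the partition removed in round j.
  survivor-crosses-heavy : ∀ {j i y} → i ∈ remaining (suc j) → ClassCross i y → t ≤ degree j y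
  survivor-crosses-heavy {j} {i} {y} i∈S′ cross = decidable-stable (t ≤? degree j y) λ t≰deg →
    let i∈S = remaining-shrinks j i∈S′
        crisp : Crisp E (remaining j) t i
        crisp = i∈S , Class y , from (crossᵇ⇔Crosses (E i) ⊤ (Class y)) (to ClassCross⇔Crosses cross) , ≰⇒> t≰deg
        i∈P : i ∈ partition j
        i∈P = proj₂ (proj₁ (spec (remaining j) t)) i crisp
        i∉P = proj₂ (to (∈-─ (remaining j) (partition j)) (subst (i ∈_) (remaining-step j) i∈S′))
    in i∉P i∈P

  active⊆heavy : ∀ j → active (suc j) ⊆ heavy j
  active⊆heavy j y∈ =
    let (i , i∈live′ , cross) = to (∈-touched {remaining (suc j)} {⊤}) y∈
        (i∈S′ , _ , inter) = to (∈-interEdges {remaining (suc j)} {⊤}) i∈live′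
        i∈live = from (∈-interEdges {remaining j} {⊤}) (remaining-shrinks j i∈S′ , ⊆⊤ , inter)
    in from (∈-heavy {j}) (from (∈-touched {remaining j} {⊤}) (i , i∈live , cross) , survivor-crosses-heavy {j} i∈S′ cross)

  -- Double counting: each live edge crosses at most r class boundaries.
  ∑degree≤r*∣live∣ : ∀ j → ∑[ y < c ] degree j y ≤ r * ∣ live j ∣
  ∑degree≤r*∣live∣ j =
    ≤-trans (≤-reflexive (∑∣D∣≡∑∣column∣ D)) (∑≤r*∣support∣ r (λ i → ∣ column D i ∣) (live j) dead-column bounded)
    where
    D : Fin c → Subset m
    D y = δ E (remaining j) ⊤ (Class y)
    crosses : ∀ {i y} → y ∈ column D i → i ∈ remaining j × ClassCross i y
    crosses {i} {y} y∈ =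
      let (i∈S , _ , cr) = to (∈-δ E (remaining j) ⊤ (Class y)) (to (∈-column D) y∈)
      in i∈S , from ClassCross⇔Crosses cr
    dead-column : ∀ i → i ∉ live j → ∣ column D i ∣ ≡ 0
    dead-column i i∉live = ∣empty∣≡0 λ (y , y∈) →
      let (i∈S , cross) = crosses y∈ in i∉live (from (∈-interEdges {remaining j} {⊤}) (i∈S , ⊆⊤ , (y , cross)))
    bounded : ∀ i → ∣ column D i ∣ ≤ r
    bounded i = begin
      ∣ column D i ∣         ≤⟨ p⊆q⇒∣p∣≤∣q∣ column⊆image ⟩
      ∣ image cls (E i) ∣    ≤⟨ ∣image∣≤∣e∣ cls (E i) ⟩
      ∣ E i ∣                ≤⟨ edge-size≤rank E i ⟩
      rank E                 ≡⟨ rank≡r ⟩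
      r                      ∎
      where
      open ≤-Reasoning
      column⊆image : column D i ⊆ image cls (E i)
      column⊆image y∈ = let (_ , (a , a∈e , a-in) , _) = crosses y∈ in subst (_∈ image cls (E i)) a-in (∈-image cls a∈e)

  t*∣heavy∣≤∑degree : ∀ j → t * ∣ heavy j ∣ ≤ ∑[ y < c ] degree j y
  t*∣heavy∣≤∑degree j = t*∣H∣≤∑ t (degree j) (heavy j) λ y y∈ → proj₂ (to (∈-heavy {j}) y∈)

  ⊤-saturated : Saturated ⊤
  ⊤-saturated _ _ = ∈⊤

  -- When some edge is live, t ∣heavy∣ ≤ r ∣live∣ ≤ r (k ∣active∣ - k)
  -- gives 2 ∣heavy∣ < ∣active∣.
  halving-live : ∀ j → Nonempty (live j) → 2 * ∣ active (suc j) ∣ ≤ ∣ active j ∣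
  halving-live j (i , i∈live) = begin
    2 * ∣ active (suc j) ∣   ≤⟨ *-monoʳ-≤ 2 (p⊆q⇒∣p∣≤∣q∣ (active⊆heavy j)) ⟩
    2 * h                    ≤⟨ m≤m+n (2 * h) 1 ⟩
    2 * h + 1                ≤⟨ *-cancelˡ-≤ (r * k) ⦃ >-nonZero (*-mono-≤ 1≤r 1≤k) ⦄ rk[2h+1]≤rkb ⟩
    b                        ∎
    where
    open ≤-Reasoning
    h f b : ℕ
    h = ∣ heavy j ∣
    f = ∣ live j ∣
    b = ∣ active j ∣
    1≤r : 1 ≤ r
    1≤r = let (_ , _ , (_ , (a , a∈e , _) , _)) = to (∈-interEdges {remaining j} {⊤}) i∈live
          in ≤-trans (nonempty⇒∣p∣≥1 (a , a∈e)) (≤-trans (edge-size≤rank E i) (≤-reflexive rank≡r))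
    f+k≤kb : f + k ≤ k * b
    f+k≤kb = sparse-nonzero (sparse (remaining j) ⊤-saturated) (nonempty⇒∣p∣≥1 (i , i∈live))
    rk[2h+1]≤rkb : r * k * (2 * h + 1) ≤ r * k * b
    rk[2h+1]≤rkb = begin
      r * k * (2 * h + 1)    ≡⟨ solve 3 (λ r k h → r :* k :* (con 2 :* h :+ con 1) := con 2 :* r :* k :* h :+ r :* k) refl r k h ⟩
      t * h + r * k          ≤⟨ +-monoˡ-≤ (r * k) (≤-trans (t*∣heavy∣≤∑degree j) (∑degree≤r*∣live∣ j)) ⟩
      r * f + r * k          ≡⟨ *-distribˡ-+ r f k ⟨
      r * (f + k)            ≤⟨ *-monoʳ-≤ r f+k≤kb ⟩
      r * (k * b)            ≡⟨ *-assoc r k b ⟨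
      r * k * b              ∎

  halving-dead : ∀ j → Empty (live j) → 2 * ∣ active (suc j) ∣ ≤ ∣ active j ∣
  halving-dead j none = begin
    2 * ∣ active (suc j) ∣   ≡⟨ cong (2 *_) (n≤0⇒n≡0 (≤-trans next≤heavy (≤-trans heavy≤active (≤-reflexive no-active)))) ⟩
    0                        ≤⟨ z≤n ⟩
    ∣ active j ∣             ∎
    where
    open ≤-Reasoning
    no-active : ∣ active j ∣ ≡ 0
    no-active = ∣empty∣≡0 λ (y , y∈) →
      let (i , i∈live , _) = to (∈-touched {remaining j} {⊤}) y∈ in none (i , i∈live)
    next≤heavy : ∣ active (suc j) ∣ ≤ ∣ heavy j ∣
    next≤heavy = p⊆q⇒∣p∣≤∣q∣ (active⊆heavy j)
    heavy≤active : ∣ heavy j ∣ ≤ ∣ active j ∣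
    heavy≤active = p⊆q⇒∣p∣≤∣q∣ (heavy⊆active j)

  halving : ∀ j → 2 * ∣ active (suc j) ∣ ≤ ∣ active j ∣
  halving j = [ halving-live j , halving-dead j ]′ (toSum (nonempty? (live j)))

  decay : ∀ j → 2 ^ j * ∣ active j ∣ ≤ ∣ active 0 ∣
  decay zero    = ≤-reflexive (*-identityˡ _)
  decay (suc j) = begin
    2 * 2 ^ j * ∣ active (suc j) ∣    ≡⟨ *-assoc 2 (2 ^ j) _ ⟩
    2 * (2 ^ j * ∣ active (suc j) ∣)  ≡⟨ x∙yz≈y∙xz 2 (2 ^ j) _ ⟩
    2 ^ j * (2 * ∣ active (suc j) ∣)  ≤⟨ *-monoʳ-≤ (2 ^ j) (halving j) ⟩
    2 ^ j * ∣ active j ∣              ≤⟨ decay j ⟩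
    ∣ active 0 ∣                      ∎
    where open ≤-Reasoning

  exhausted : ∀ J → n < 2 ^ J → ∣ active J ∣ ≡ 0
  exhausted J n<2^J = m*x<m⇒x≡0 (2 ^ J) ∣ active J ∣ (begin-strict
    2 ^ J * ∣ active J ∣     ≤⟨ decay J ⟩
    ∣ active 0 ∣             ≤⟨ ∣p∣≤n (active 0) ⟩
    c                        ≤⟨ c≤n ⟩
    n                        <⟨ n<2^J ⟩
    2 ^ J                    ∎)
    where open ≤-Reasoning

  weak-removed : ∀ J → ∣ active J ∣ ≡ 0 → ∀ i → Nonempty (E i) → Weak E ⊤ k i → i ∈ removed J
  weak-removed J none i nonempty weak = decidable-stable (i ∈? removed J) λ i∉R →
    let (y , cross) = weak⇒crossing nonempty weak
        i∈live = from (∈-interEdges {remaining J} {⊤}) (from (∈-─ ⊤ (removed J)) (∈⊤ , i∉R) , ⊆⊤ , (y , cross))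
        y∈active = from (∈-touched {remaining J} {⊤}) (i , i∈live , cross)
    in <⇒≱ (nonempty⇒∣p∣≥1 (y , y∈active)) (≤-reflexive none)

n<2^[1+⌊log₂n⌋] : ∀ n → n < 2 ^ suc ⌊log₂ n ⌋
n<2^[1+⌊log₂n⌋] n with 2 ^ suc ⌊log₂ n ⌋ ≤? n
... | no  2^J≰n = ≰⇒> 2^J≰n
... | yes 2^J≤n = ⊥-elim (1+n≰n (begin
  suc ⌊log₂ n ⌋              ≡⟨ ⌊log₂[2^n]⌋≡n (suc ⌊log₂ n ⌋) ⟨
  ⌊log₂ 2 ^ suc ⌊log₂ n ⌋ ⌋  ≤⟨ ⌊log₂⌋-mono-≤ 2^J≤n ⟩
  ⌊log₂ n ⌋                  ∎))
  where open ≤-Reasoning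

theorem13 : (n m : ℕ) (E : Fin m → Subset n) (r k : ℕ) →
    (∀ i → Nonempty (E i)) → rank E ≡ r → 1 ≤ k →
    (part : PartitionProc E) → PartitionSpec E part →
    Light E ⊤ (4 * r * k) (proj₁ (weakEdges E part r k (suc ⌊log₂ n ⌋)))
    × (∀ i → Weak E ⊤ k i → i ∈ proj₁ (weakEdges E part r k (suc ⌊log₂ n ⌋)))
    × proj₂ (weakEdges E part r k (suc ⌊log₂ n ⌋)) ≡ suc ⌊log₂ n ⌋
theorem13 n m E r k nonempty rank≡r 1≤k part spec
  rewrite Rounds.weakLoop-from-start E part (2 * r * k) (suc ⌊log₂ n ⌋) =
    subst (λ ℓ → Light E ⊤ ℓ (removed J)) 2*[2*r*k]≡4*r*k (removed-light spec J) ,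
    (λ i → weak-removed J (exhausted J (n<2^[1+⌊log₂n⌋] n)) i (nonempty i)) ,
    refl
  where
  J : ℕ
  J = suc ⌊log₂ n ⌋
  open Halving E r k rank≡r 1≤k part spec
  open Rounds E part t
  2*[2*r*k]≡4*r*k : 2 * (2 * r * k) ≡ 4 * r * k
  2*[2*r*k]≡4*r*k = solve 2 (λ r k → con 2 :* (con 2 :* r :* k) := con 4 :* r :* k) refl r k
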